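{- For each non-negative integer $n$, \[ \sum_{k=0}^n \binom {n+k}{k} F_{n+2k+1} = (-1)^{n} - \sum_{k=0}^{n-1} (-1)^{n-k} \binom {2k+1}{k} F_{3(k+2)}, \] \[ \sum_{k=0}^n \binom {n+k}{k} L_{n+2k+1} = (-1)^{n} - \sum_{k=0}^{n-1} (-1)^{n-k} \binom {2k+1}{k} L_{3(k+2)}. \]
   Context: $F_j$ and $L_j$ denote the Fibonacci and Lucas numbers: $F_0=0,F_1=1$, $L_0=2,L_1=1$, both satisfying $X_j=X_{j-1}+X_{j-2}$. -}

module Defs where

open import Data.Nat as ℕ using (ℕ; zero; suc)
open import Data.Nat.Combinatorics using (_C_)
open import Data.Integer as ℤ using (ℤ; +_; -_)

fib : ℕ → ℕ
fib zero = 0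
fib (suc zero) = 1
fib (suc (suc n)) = fib (suc n) ℕ.+ fib n

lucas : ℕ → ℕ
lucas zero = 2
lucas (suc zero) = 1
lucas (suc (suc n)) = lucas (suc n) ℕ.+ lucas n

sgn : ℕ → ℤ
sgn zero = + 1
sgn (suc n) = - sgn n

sumBelow : ℕ → (ℕ → ℤ) → ℤ
sumBelow zero f = + 0
sumBelow (suc n) f = sumBelow n f ℤ.+ f n

{-# OPTIONS --safe #-}
-- Write B n N m = Σ_{k<N} C(n+k,k) g_{m+2k} for a sequence g obeying the Fibonacci recurrence.
-- B is Fibonacci-like in m, and Pascal's rule C(n+1+k,k) = C(n+k,k) + C(n+k,k-1) splits
-- B (n+1) in the two directions n and m.  For the diagonal sums T n m = B n (n+1) m,
-- comparing the two splittings of T (n+1) (m+2), and using C(2n+2,n+1) = 2 C(2n+1,n), gives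
--   T (n+1) (m+1) + T n m = C(2n+1,n) g_{m+2n+5},
-- so S n = T n (n+1) satisfies S (n+1) + S n = C(2n+1,n) g_{3(n+2)} with S 0 = g_1 = 1,
-- and the stated alternating sum is the unique solution of that recurrence.
module Submission where

open import Defs
open import Data.Nat as ℕ using (ℕ; zero; suc; _∸_)
open import Data.Nat.Combinatorics using (_C_; nCk+nC[k+1]≡[n+1]C[k+1]; nCk≡nC[n∸k])
open import Data.Integer as ℤ using (ℤ; +_)
open import Data.Product using (_×_; _,_)
open import Relation.Binary.PropositionalEquality
import Data.Nat.Properties as ℕP
import Data.Integer.Properties as ℤP
import Data.Nat.Tactic.RingSolver as ℕSolver
import Data.Integer.Tactic.RingSolver as ℤSolver

sumBelowℕ : ℕ → (ℕ → ℕ) → ℕ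
sumBelowℕ zero    f = 0
sumBelowℕ (suc N) f = sumBelowℕ N f ℕ.+ f N

sumBelowℕ-cong : ∀ N {f h : ℕ → ℕ} → (∀ k → f k ≡ h k) → sumBelowℕ N f ≡ sumBelowℕ N h
sumBelowℕ-cong zero    f≡h = refl
sumBelowℕ-cong (suc N) f≡h = cong₂ ℕ._+_ (sumBelowℕ-cong N f≡h) (f≡h N)

sumBelowℕ-distrib-+ : ∀ N (f h : ℕ → ℕ) →
  sumBelowℕ N (λ k → f k ℕ.+ h k) ≡ sumBelowℕ N f ℕ.+ sumBelowℕ N h
sumBelowℕ-distrib-+ zero    f h = refl
sumBelowℕ-distrib-+ (suc N) f h = begin
  sumBelowℕ N (λ k → f k ℕ.+ h k) ℕ.+ (f N ℕ.+ h N)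
    ≡⟨ cong (ℕ._+ (f N ℕ.+ h N)) (sumBelowℕ-distrib-+ N f h) ⟩
  sumBelowℕ N f ℕ.+ sumBelowℕ N h ℕ.+ (f N ℕ.+ h N)
    ≡⟨ interchange (sumBelowℕ N f) (sumBelowℕ N h) (f N) (h N) ⟩
  sumBelowℕ N f ℕ.+ f N ℕ.+ (sumBelowℕ N h ℕ.+ h N) ∎
  where
  open ≡-Reasoning
  interchange : ∀ a b c d → a ℕ.+ b ℕ.+ (c ℕ.+ d) ≡ a ℕ.+ c ℕ.+ (b ℕ.+ d)
  interchange = ℕSolver.solve-∀

sumBelow-+ : ∀ N (f : ℕ → ℕ) → sumBelow N (λ k → + f k) ≡ + sumBelowℕ N f
sumBelow-+ zero    f = refl
sumBelow-+ (suc N) f = cong (ℤ._+ + f N) (sumBelow-+ N f)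

sumBelow-cong< : ∀ N {f h : ℕ → ℤ} → (∀ k → k ℕ.< N → f k ≡ h k) → sumBelow N f ≡ sumBelow N h
sumBelow-cong< zero    f≡h = refl
sumBelow-cong< (suc N) f≡h =
  cong₂ ℤ._+_ (sumBelow-cong< N (λ k k<N → f≡h k (ℕP.m<n⇒m<1+n k<N))) (f≡h N ℕP.≤-refl)

sumBelow-neg : ∀ N (f : ℕ → ℤ) → sumBelow N (λ k → ℤ.- f k) ≡ ℤ.- sumBelow N f
sumBelow-neg zero    f = refl
sumBelow-neg (suc N) f =
  trans (cong (ℤ._+ ℤ.- f N) (sumBelow-neg N f)) (sym (ℤP.neg-distrib-+ (sumBelow N f) (f N)))

sgn-suc-∸ : ∀ {k n} → k ℕ.≤ n → sgn (suc n ∸ k) ≡ ℤ.- sgn (n ∸ k)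
sgn-suc-∸ k≤n = cong sgn (ℕP.+-∸-assoc 1 k≤n)

alternatingSum-suc : ∀ n (a : ℕ → ℤ) →
  sumBelow (suc n) (λ k → sgn (suc n ∸ k) ℤ.* a k)
    ≡ ℤ.- (sumBelow n (λ k → sgn (n ∸ k) ℤ.* a k) ℤ.+ a n)
alternatingSum-suc n a = begin
  sumBelow (suc n) (λ k → sgn (suc n ∸ k) ℤ.* a k)
    ≡⟨ sumBelow-cong< (suc n) (λ k k<1+n →
         trans (cong (ℤ._* a k) (sgn-suc-∸ {k} {n} (ℕP.≤-pred k<1+n))) (sym (ℤP.neg-distribˡ-* (sgn (n ∸ k)) (a k)))) ⟩
  sumBelow (suc n) (λ k → ℤ.- (sgn (n ∸ k) ℤ.* a k))
    ≡⟨ sumBelow-neg (suc n) (λ k → sgn (n ∸ k) ℤ.* a k) ⟩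
  ℤ.- (sumBelow n (λ k → sgn (n ∸ k) ℤ.* a k) ℤ.+ sgn (n ∸ n) ℤ.* a n)
    ≡⟨ cong (λ i → ℤ.- (sumBelow n (λ k → sgn (n ∸ k) ℤ.* a k) ℤ.+ sgn i ℤ.* a n)) (ℕP.n∸n≡0 n) ⟩
  ℤ.- (sumBelow n (λ k → sgn (n ∸ k) ℤ.* a k) ℤ.+ + 1 ℤ.* a n)
    ≡⟨ cong (λ x → ℤ.- (sumBelow n (λ k → sgn (n ∸ k) ℤ.* a k) ℤ.+ x)) (ℤP.*-identityˡ (a n)) ⟩
  ℤ.- (sumBelow n (λ k → sgn (n ∸ k) ℤ.* a k) ℤ.+ a n) ∎
  where open ≡-Reasoning

alternating-solution : (s a : ℕ → ℤ) → (∀ n → s (suc n) ℤ.+ s n ≡ a n) →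
  ∀ n → s n ≡ sgn n ℤ.* s 0 ℤ.- sumBelow n (λ k → sgn (n ∸ k) ℤ.* a k)
alternating-solution s a step zero = initial (s 0)
  where
  initial : ∀ x → x ≡ + 1 ℤ.* x ℤ.- + 0
  initial = ℤSolver.solve-∀
alternating-solution s a step (suc n) = begin
  s (suc n)
    ≡⟨ add-sub (s (suc n)) (s n) ⟩
  (s (suc n) ℤ.+ s n) ℤ.- s n
    ≡⟨ cong₂ ℤ._-_ (step n) (alternating-solution s a step n) ⟩
  a n ℤ.- (sgn n ℤ.* s 0 ℤ.- Σn)
    ≡⟨ rearrange (a n) (sgn n) (s 0) Σn ⟩
  ℤ.- sgn n ℤ.* s 0 ℤ.- ℤ.- (Σn ℤ.+ a n)
    ≡⟨ cong (λ t → ℤ.- sgn n ℤ.* s 0 ℤ.- t) (sym (alternatingSum-suc n a)) ⟩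
  sgn (suc n) ℤ.* s 0 ℤ.- sumBelow (suc n) (λ k → sgn (suc n ∸ k) ℤ.* a k) ∎
  where
  open ≡-Reasoning
  Σn = sumBelow n (λ k → sgn (n ∸ k) ℤ.* a k)
  add-sub : ∀ x y → x ≡ (x ℤ.+ y) ℤ.- y
  add-sub = ℤSolver.solve-∀
  rearrange : ∀ a σ s₀ t → a ℤ.- (σ ℤ.* s₀ ℤ.- t) ≡ ℤ.- σ ℤ.* s₀ ℤ.- ℤ.- (t ℤ.+ a)
  rearrange = ℤSolver.solve-∀

C-middle-sym : ∀ n → (n ℕ.+ suc n) C suc n ≡ (n ℕ.+ suc n) C n
C-middle-sym n =
  trans (nCk≡nC[n∸k] (ℕP.m≤n+m (suc n) n)) (cong ((n ℕ.+ suc n) C_) (ℕP.m+n∸n≡m n (suc n)))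

C-central≡2*C-middle : ∀ n → (suc n ℕ.+ suc n) C suc n ≡ 2 ℕ.* ((n ℕ.+ suc n) C n)
C-central≡2*C-middle n = begin
  (suc n ℕ.+ suc n) C suc n
    ≡⟨ sym (nCk+nC[k+1]≡[n+1]C[k+1] (n ℕ.+ suc n) n) ⟩
  (n ℕ.+ suc n) C n ℕ.+ (n ℕ.+ suc n) C suc n
    ≡⟨ cong ((n ℕ.+ suc n) C n ℕ.+_) (C-middle-sym n) ⟩
  (n ℕ.+ suc n) C n ℕ.+ (n ℕ.+ suc n) C n
    ≡⟨ cong ((n ℕ.+ suc n) C n ℕ.+_) (sym (ℕP.+-identityʳ _)) ⟩
  2 ℕ.* ((n ℕ.+ suc n) C n) ∎
  where open ≡-Reasoning

module FibonacciLike (g : ℕ → ℕ) (g-rec : ∀ j → g (2 ℕ.+ j) ≡ g (1 ℕ.+ j) ℕ.+ g j) where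

  twice-rec : ∀ j → 2 ℕ.* g (2 ℕ.+ j) ≡ g (3 ℕ.+ j) ℕ.+ g j
  twice-rec j = begin
    2 ℕ.* g (2 ℕ.+ j)                       ≡⟨ double (g (2 ℕ.+ j)) ⟩
    g (2 ℕ.+ j) ℕ.+ g (2 ℕ.+ j)             ≡⟨ cong (g (2 ℕ.+ j) ℕ.+_) (g-rec j) ⟩
    g (2 ℕ.+ j) ℕ.+ (g (1 ℕ.+ j) ℕ.+ g j)   ≡⟨ sym (ℕP.+-assoc (g (2 ℕ.+ j)) (g (1 ℕ.+ j)) (g j)) ⟩
    g (2 ℕ.+ j) ℕ.+ g (1 ℕ.+ j) ℕ.+ g j     ≡⟨ cong (ℕ._+ g j) (sym (g-rec (1 ℕ.+ j))) ⟩
    g (3 ℕ.+ j) ℕ.+ g j                     ∎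
    where
    open ≡-Reasoning
    double : ∀ x → 2 ℕ.* x ≡ x ℕ.+ x
    double = ℕSolver.solve-∀

  binomialSum : ℕ → ℕ → ℕ → ℕ
  binomialSum n N m = sumBelowℕ N (λ k → ((n ℕ.+ k) C k) ℕ.* g (m ℕ.+ 2 ℕ.* k))

  binomialSum-rec : ∀ n N m →
    binomialSum n N (2 ℕ.+ m) ≡ binomialSum n N (1 ℕ.+ m) ℕ.+ binomialSum n N m
  binomialSum-rec n N m = trans
    (sumBelowℕ-cong N (λ k →
      trans (cong (((n ℕ.+ k) C k) ℕ.*_) (g-rec (m ℕ.+ 2 ℕ.* k)))
            (ℕP.*-distribˡ-+ ((n ℕ.+ k) C k) (g (1 ℕ.+ m ℕ.+ 2 ℕ.* k)) (g (m ℕ.+ 2 ℕ.* k)))))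
    (sumBelowℕ-distrib-+ N (λ k → ((n ℕ.+ k) C k) ℕ.* g (1 ℕ.+ m ℕ.+ 2 ℕ.* k))
                           (λ k → ((n ℕ.+ k) C k) ℕ.* g (m ℕ.+ 2 ℕ.* k)))

  binomialSum-pascal : ∀ n N m →
    binomialSum (suc n) (suc N) m ≡ binomialSum n (suc N) m ℕ.+ binomialSum (suc n) N (2 ℕ.+ m)
  binomialSum-pascal n zero    m = sym (ℕP.+-identityʳ _)
  binomialSum-pascal n (suc N) m = begin
    binomialSum (suc n) (suc N) m ℕ.+ ((suc n ℕ.+ suc N) C suc N) ℕ.* G
      ≡⟨ cong₂ (λ z c → z ℕ.+ c ℕ.* G) (binomialSum-pascal n N m)
               (sym (nCk+nC[k+1]≡[n+1]C[k+1] (n ℕ.+ suc N) N)) ⟩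
    X ℕ.+ Y ℕ.+ (a ℕ.+ b) ℕ.* G
      ≡⟨ regroup X Y a b G ⟩
    X ℕ.+ b ℕ.* G ℕ.+ (Y ℕ.+ a ℕ.* G)
      ≡⟨ cong₂ (λ c j → X ℕ.+ b ℕ.* G ℕ.+ (Y ℕ.+ c ℕ.* g j))
               (cong (_C N) (ℕP.+-suc n N)) (index m N) ⟩
    binomialSum n (suc (suc N)) m ℕ.+ binomialSum (suc n) (suc N) (2 ℕ.+ m) ∎
    where
    open ≡-Reasoning
    G = g (m ℕ.+ 2 ℕ.* suc N)
    X = binomialSum n (suc N) m
    Y = binomialSum (suc n) N (2 ℕ.+ m)
    a = (n ℕ.+ suc N) C N
    b = (n ℕ.+ suc N) C suc N
    regroup : ∀ X Y a b G → X ℕ.+ Y ℕ.+ (a ℕ.+ b) ℕ.* G ≡ X ℕ.+ b ℕ.* G ℕ.+ (Y ℕ.+ a ℕ.* G)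
    regroup = ℕSolver.solve-∀
    index : ∀ m N → m ℕ.+ 2 ℕ.* suc N ≡ 2 ℕ.+ m ℕ.+ 2 ℕ.* N
    index = ℕSolver.solve-∀

  diagonalSum : ℕ → ℕ → ℕ
  diagonalSum n = binomialSum n (suc n)

  diagonalSum-step : ∀ n m →
    diagonalSum (suc n) (suc m) ℕ.+ diagonalSum n m ≡ ((n ℕ.+ suc n) C n) ℕ.* g (3 ℕ.+ (m ℕ.+ 2 ℕ.* suc n))
  diagonalSum-step n m = ℕP.+-cancelʳ-≡ (c ℕ.* g j ℕ.+ R) _ _ (begin
    X ℕ.+ Y ℕ.+ (c ℕ.* g j ℕ.+ R)           ≡⟨ regroup X Y (c ℕ.* g j) R ⟩
    Y ℕ.+ c ℕ.* g j ℕ.+ R ℕ.+ X             ≡⟨ cong (ℕ._+ X) (sym split-by-pascal) ⟩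
    diagonalSum (suc n) m ℕ.+ X             ≡⟨ ℕP.+-comm _ X ⟩
    X ℕ.+ diagonalSum (suc n) m             ≡⟨ sym (binomialSum-rec (suc n) (2 ℕ.+ n) m) ⟩
    diagonalSum (suc n) (2 ℕ.+ m)           ≡⟨ cong (λ b → R ℕ.+ b ℕ.* g (2 ℕ.+ j)) (C-central≡2*C-middle n) ⟩
    R ℕ.+ 2 ℕ.* c ℕ.* g (2 ℕ.+ j)           ≡⟨ cong (R ℕ.+_) top-term ⟩
    R ℕ.+ c ℕ.* (g (3 ℕ.+ j) ℕ.+ g j)       ≡⟨ distribute R c (g (3 ℕ.+ j)) (g j) ⟩
    c ℕ.* g (3 ℕ.+ j) ℕ.+ (c ℕ.* g j ℕ.+ R) ∎)
    where
    open ≡-Reasoning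
    c = (n ℕ.+ suc n) C n
    j = m ℕ.+ 2 ℕ.* suc n
    R = binomialSum (suc n) (suc n) (2 ℕ.+ m)
    X = diagonalSum (suc n) (suc m)
    Y = diagonalSum n m
    split-by-pascal : diagonalSum (suc n) m ≡ Y ℕ.+ c ℕ.* g j ℕ.+ R
    split-by-pascal = trans (binomialSum-pascal n (suc n) m)
                            (cong (λ b → Y ℕ.+ b ℕ.* g j ℕ.+ R) (C-middle-sym n))
    swap-2 : ∀ c x → 2 ℕ.* c ℕ.* x ≡ c ℕ.* (2 ℕ.* x)
    swap-2 = ℕSolver.solve-∀
    top-term : 2 ℕ.* c ℕ.* g (2 ℕ.+ j) ≡ c ℕ.* (g (3 ℕ.+ j) ℕ.+ g j)
    top-term = trans (swap-2 c (g (2 ℕ.+ j))) (cong (c ℕ.*_) (twice-rec j))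
    regroup : ∀ X Y Z R → X ℕ.+ Y ℕ.+ (Z ℕ.+ R) ≡ Y ℕ.+ Z ℕ.+ R ℕ.+ X
    regroup = ℕSolver.solve-∀
    distribute : ∀ R c x y → R ℕ.+ c ℕ.* (x ℕ.+ y) ≡ c ℕ.* x ℕ.+ (c ℕ.* y ℕ.+ R)
    distribute = ℕSolver.solve-∀

  alternating-identity : g 1 ≡ 1 → ∀ n →
    sumBelow (suc n) (λ k → + (((n ℕ.+ k) C k) ℕ.* g (n ℕ.+ 2 ℕ.* k ℕ.+ 1)))
      ≡ sgn n ℤ.- sumBelow n (λ k → sgn (n ∸ k) ℤ.* + (((2 ℕ.* k ℕ.+ 1) C k) ℕ.* g (3 ℕ.* (k ℕ.+ 2))))
  alternating-identity g1≡1 n = begin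
    sumBelow (suc n) (λ k → + (((n ℕ.+ k) C k) ℕ.* g (n ℕ.+ 2 ℕ.* k ℕ.+ 1)))
      ≡⟨ sumBelow-+ (suc n) (λ k → ((n ℕ.+ k) C k) ℕ.* g (n ℕ.+ 2 ℕ.* k ℕ.+ 1)) ⟩
    + sumBelowℕ (suc n) (λ k → ((n ℕ.+ k) C k) ℕ.* g (n ℕ.+ 2 ℕ.* k ℕ.+ 1))
      ≡⟨ cong +_ (sumBelowℕ-cong (suc n) (λ k → cong (λ i → ((n ℕ.+ k) C k) ℕ.* g i) (shift n k))) ⟩
    s n
      ≡⟨ alternating-solution s a s-step n ⟩
    sgn n ℤ.* s 0 ℤ.- Σ
      ≡⟨ cong (λ x → sgn n ℤ.* + (1 ℕ.* x) ℤ.- Σ) g1≡1 ⟩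
    sgn n ℤ.* + 1 ℤ.- Σ
      ≡⟨ cong (ℤ._- Σ) (ℤP.*-identityʳ (sgn n)) ⟩
    sgn n ℤ.- Σ ∎
    where
    open ≡-Reasoning
    s : ℕ → ℤ
    s i = + diagonalSum i (suc i)
    a : ℕ → ℤ
    a k = + (((2 ℕ.* k ℕ.+ 1) C k) ℕ.* g (3 ℕ.* (k ℕ.+ 2)))
    Σ = sumBelow n (λ k → sgn (n ∸ k) ℤ.* a k)
    shift : ∀ n k → n ℕ.+ 2 ℕ.* k ℕ.+ 1 ≡ suc n ℕ.+ 2 ℕ.* k
    shift = ℕSolver.solve-∀
    middle : ∀ n → n ℕ.+ suc n ≡ 2 ℕ.* n ℕ.+ 1
    middle = ℕSolver.solve-∀
    top : ∀ n → 3 ℕ.+ (suc n ℕ.+ 2 ℕ.* suc n) ≡ 3 ℕ.* (n ℕ.+ 2)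
    top = ℕSolver.solve-∀
    s-step : ∀ i → s (suc i) ℤ.+ s i ≡ a i
    s-step i = cong +_ (trans (diagonalSum-step i (suc i))
                              (cong₂ (λ m j → (m C i) ℕ.* g j) (middle i) (top i)))

theorem13 : (n : ℕ) →
    (sumBelow (ℕ.suc n) (λ k → + (((n ℕ.+ k) C k) ℕ.* fib (n ℕ.+ 2 ℕ.* k ℕ.+ 1)))
      ≡ sgn n ℤ.- sumBelow n (λ k → sgn (n ∸ k) ℤ.* + (((2 ℕ.* k ℕ.+ 1) C k) ℕ.* fib (3 ℕ.* (k ℕ.+ 2)))))
    × (sumBelow (ℕ.suc n) (λ k → + (((n ℕ.+ k) C k) ℕ.* lucas (n ℕ.+ 2 ℕ.* k ℕ.+ 1)))
      ≡ sgn n ℤ.- sumBelow n (λ k → sgn (n ∸ k) ℤ.* + (((2 ℕ.* k ℕ.+ 1) C k) ℕ.* lucas (3 ℕ.* (k ℕ.+ 2)))))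
theorem13 n = FibonacciLike.alternating-identity fib (λ _ → refl) refl n
            , FibonacciLike.alternating-identity lucas (λ _ → refl) refl n
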